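{- Let $G$ be a graph, $k$ an integer and $X$ a vertex cover of $G$. Let $X^b$ be the set of vertices of $X$ with at least $k+1$ neighbours in $V(G)\setminus X$ and $X^s=X\setminus X^b$. Let $Y_1,\dots,Y_q$ be the partition of $V(G)\setminus X$ into maximal modules, and for $i\in[q]$ let $X_i$ be the set of neighbours of $Y_i$ in $X^s$. If for some $i\in[q]$ we have $X_i\neq\emptyset$ and $|Y_i|\ge |X_i|+2$, and $G'$ is obtained from $G$ by deleting one vertex of $Y_i$, then $(G,k)$ is a yes-instance of Connected $k$-Vertex Cover if and only if $(G',k)$ is.
   Context: A set $S\subseteq V(G)$ is a module if every vertex outside $S$ is adjacent to all or to none of $S$. Connected $k$-Vertex Cover: given a graph $G$ and integer $k$, decide whether $G$ has a vertex cover $T$ with $|T|\le k$ such that $G[T]$ is connected. -}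

module Defs where

open import Data.Nat using (ℕ; suc; _+_; _≤_; _≤ᵇ_)
open import Data.Bool using (Bool; true; false; _∧_; not)
open import Data.Fin using (Fin; punchIn)
open import Data.Fin.Subset using (Subset; _∈_; _∉_; _⊆_; ∁; ∣_∣)
open import Data.Vec using (lookup; tabulate)
open import Data.List using (allFin)
open import Data.Bool.ListAction using (any)
open import Data.Product using (Σ; ∃; _×_; _,_)
open import Data.Sum using (_⊎_)
open import Relation.Binary.PropositionalEquality using (_≡_)

record Graph (n : ℕ) : Set where
  field
    adj    : Fin n → Fin n → Bool
    sym    : ∀ i j → adj i j ≡ adj j i
    irrefl : ∀ i → adj i i ≡ false
open Graph public

delete : ∀ {n} → Graph (suc n) → Fin (suc n) → Graph n
delete G v = record
  { adj    = λ i j → adj G (punchIn v i) (punchIn v j)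
  ; sym    = λ i j → sym G (punchIn v i) (punchIn v j)
  ; irrefl = λ i → irrefl G (punchIn v i) }

VertexCover : ∀ {n} → Graph n → Subset n → Set
VertexCover G T = ∀ u v → adj G u v ≡ true → u ∈ T ⊎ v ∈ T

data Reach {n} (G : Graph n) (T : Subset n) : Fin n → Fin n → Set where
  here : ∀ {u} → u ∈ T → Reach G T u u
  step : ∀ {u w v} → u ∈ T → adj G u w ≡ true → Reach G T w v → Reach G T u v

Connected : ∀ {n} → Graph n → Subset n → Set
Connected G T = ∀ u v → u ∈ T → v ∈ T → Reach G T u v

ConnectedVC : ∀ {n} → Graph n → ℕ → Set
ConnectedVC G k = ∃ λ T → ∣ T ∣ ≤ k × VertexCover G T × Connected G T

IsModule : ∀ {n} → Graph n → Subset n → Set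
IsModule G S = ∀ w → w ∉ S → ∀ u v → u ∈ S → v ∈ S → adj G w u ≡ adj G w v

-- Y is a maximal module among the modules contained in V(G) \ X,
-- i.e. one of the parts Y_i of the partition of V(G) \ X into maximal modules
MaximalModuleOutside : ∀ {n} → Graph n → Subset n → Subset n → Set
MaximalModuleOutside G X Y =
  (∃ λ y → y ∈ Y) × Y ⊆ ∁ X × IsModule G Y ×
  (∀ Z → Y ⊆ Z → Z ⊆ ∁ X → IsModule G Z → Z ≡ Y)

nbrsOutside : ∀ {n} → Graph n → Subset n → Fin n → Subset n
nbrsOutside G X u = tabulate λ v → adj G u v ∧ not (lookup X v)

smallPart : ∀ {n} → Graph n → Subset n → ℕ → Subset n
smallPart G X k = tabulate λ u → lookup X u ∧ (∣ nbrsOutside G X u ∣ ≤ᵇ k)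

nbrsInSmall : ∀ {n} → Graph n → Subset n → ℕ → Subset n → Subset n
nbrsInSmall {n} G X k Y =
  tabulate λ x → lookup (smallPart G X k) x ∧ any (λ y → lookup Y y ∧ adj G x y) (allFin n)

{-# OPTIONS --safe #-}

-- Y is independent (it avoids the vertex cover X) and, being a module, all its vertices have
-- the same neighbourhood N ⊆ X. A connected vertex cover P meeting Y can be exchanged for
-- (P ∖ Y) ∪ (N ∖ P) ∪ {y₀}, y₀ ∈ Y: again a connected vertex cover, meeting Y only in y₀, and
-- no larger than P as soon as |N ∖ P| < |P ∩ Y|. If N ⊈ P then P contains Y - y, and each
-- vertex of N ∖ P has all its neighbours outside X in P, hence at most k of them, so it lies
-- in Xᵢ; now |Y| ≥ |Xᵢ| + 2 gives the size bound. Thus a solution of (G, k) containing y turns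
-- into one avoiding y, i.e. a solution of (G - y, k); conversely a solution of (G - y, k)
-- either already contains N, and then covers G, or is exchanged in the same way.

module Submission where

open import Defs renaming (sym to adj-sym)
open import Data.Bool using (Bool; true; false; _∧_; not)
open import Data.Bool.ListAction using (any)
open import Data.Bool.Properties using (T-≡)
open import Data.Fin using (Fin; zero; suc; punchIn; punchOut)
open import Data.Fin.Properties using (punchIn-punchOut; punchOut-punchIn; punchOut-cong; punchInᵢ≢i; _≟_)
open import Data.Fin.Subset
  using (Subset; inside; outside; _∈_; _∉_; _⊆_; ∁; ∣_∣; Nonempty; Empty; _∪_; _∩_; _─_; _-_; ⁅_⁆; ⊥)
open import Data.Fin.Subset.Properties
  using ( _∈?_; nonempty?; Empty-unique; ∣⊥∣≡0; ∣⁅x⁆∣≡1; x∈⁅x⁆; x∈⁅y⁆⇒x≡y; x≢y⇒x∉⁅y⁆; x∉⁅y⁆⇒x≢y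
        ; p⊆q⇒∣p∣≤∣q∣; x∈p⇒∣p-x∣<∣p∣; ∣p∩q∣≤∣q∣; x∈p∪q⁺; x∈p∪q⁻; x∈p∩q⁺
        ; x∈p∧x∉q⇒x∈p─q; p─q⊆p; x∈p∧x≢y⇒x∈p-y; x∈∁p⇒x∉p; ∉⊥)
open import Data.List using (allFin)
open import Data.List.Membership.Propositional.Properties using (∈-allFin)
import Data.List.Relation.Unary.Any as Any
open import Data.List.Relation.Unary.Any.Properties using (any⁺)
open import Data.Nat using (ℕ; suc; _+_; _≤_; _<_; z≤n; s≤s; s≤s⁻¹)
open import Data.Nat.Properties
  using (≤-trans; ≤-reflexive; +-suc; +-comm; +-monoʳ-≤; +-monoˡ-≤; n≤1+n; <-≤-trans; >⇒≢; ≤⇒≤ᵇ; module ≤-Reasoning)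
open import Data.Product using (∃; ∃₂; _×_; _,_; proj₁)
open import Data.Sum using (_⊎_; inj₁; inj₂)
import Data.Sum as Sum
open import Data.Vec using (_∷_; []; here; there; lookup; tabulate; insertAt; removeAt)
open import Data.Vec.Properties
  using (lookup∘tabulate; []=⇒lookup; lookup⇒[]=; insertAt-lookup; insertAt-punchIn; insertAt-removeAt)
open import Function using (_∘_)
open import Function.Bundles using (_⇔_; mk⇔; Equivalence)
open import Relation.Nullary using (Dec; yes; no; contradiction)
open import Relation.Binary.PropositionalEquality

private
  variable
    n : ℕ

∈-tabulate⁺ : ∀ {f : Fin n → Bool} {x} → f x ≡ true → x ∈ tabulate f
∈-tabulate⁺ {f = f} {x} fx = lookup⇒[]= x (tabulate f) (trans (lookup∘tabulate f x) fx)

∈-tabulate⁻ : ∀ {f : Fin n → Bool} {x} → x ∈ tabulate f → f x ≡ true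
∈-tabulate⁻ {f = f} {x} x∈ = trans (sym (lookup∘tabulate f x)) ([]=⇒lookup x∈)

x∈p─q⇒x∉q : ∀ {p q : Subset n} {x} → x ∈ p ─ q → x ∉ q
x∈p─q⇒x∉q {p = _ ∷ _} {outside ∷ _} here          ()
x∈p─q⇒x∉q {p = _ ∷ _} {_ ∷ _}       (there x∈p─q) (there x∈q) = x∈p─q⇒x∉q x∈p─q x∈q

∣p∪q∣≤∣p∣+∣q∣ : ∀ (p q : Subset n) → ∣ p ∪ q ∣ ≤ ∣ p ∣ + ∣ q ∣
∣p∪q∣≤∣p∣+∣q∣ []            []            = z≤n
∣p∪q∣≤∣p∣+∣q∣ (inside  ∷ p) (inside  ∷ q) =
  s≤s (≤-trans (∣p∪q∣≤∣p∣+∣q∣ p q) (+-monoʳ-≤ ∣ p ∣ (n≤1+n ∣ q ∣)))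
∣p∪q∣≤∣p∣+∣q∣ (inside  ∷ p) (outside ∷ q) = s≤s (∣p∪q∣≤∣p∣+∣q∣ p q)
∣p∪q∣≤∣p∣+∣q∣ (outside ∷ p) (inside  ∷ q) =
  ≤-trans (s≤s (∣p∪q∣≤∣p∣+∣q∣ p q)) (≤-reflexive (sym (+-suc ∣ p ∣ ∣ q ∣)))
∣p∪q∣≤∣p∣+∣q∣ (outside ∷ p) (outside ∷ q) = ∣p∪q∣≤∣p∣+∣q∣ p q

∣p∣≡∣p∩q∣+∣p─q∣ : ∀ (p q : Subset n) → ∣ p ∣ ≡ ∣ p ∩ q ∣ + ∣ p ─ q ∣
∣p∣≡∣p∩q∣+∣p─q∣ []            []            = refl
∣p∣≡∣p∩q∣+∣p─q∣ (inside  ∷ p) (inside  ∷ q) = cong suc (∣p∣≡∣p∩q∣+∣p─q∣ p q)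
∣p∣≡∣p∩q∣+∣p─q∣ (inside  ∷ p) (outside ∷ q) =
  trans (cong suc (∣p∣≡∣p∩q∣+∣p─q∣ p q)) (sym (+-suc ∣ p ∩ q ∣ ∣ p ─ q ∣))
∣p∣≡∣p∩q∣+∣p─q∣ (outside ∷ p) (inside  ∷ q) = ∣p∣≡∣p∩q∣+∣p─q∣ p q
∣p∣≡∣p∩q∣+∣p─q∣ (outside ∷ p) (outside ∷ q) = ∣p∣≡∣p∩q∣+∣p─q∣ p q

∣p∣≤1+∣p-x∣ : ∀ (p : Subset n) x → ∣ p ∣ ≤ 1 + ∣ p - x ∣
∣p∣≤1+∣p-x∣ p x = begin
  ∣ p ∣                         ≡⟨ ∣p∣≡∣p∩q∣+∣p─q∣ p ⁅ x ⁆ ⟩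
  ∣ p ∩ ⁅ x ⁆ ∣ + ∣ p - x ∣     ≤⟨ +-monoˡ-≤ ∣ p - x ∣ (∣p∩q∣≤∣q∣ p ⁅ x ⁆) ⟩
  ∣ ⁅ x ⁆ ∣ + ∣ p - x ∣         ≡⟨ cong (_+ ∣ p - x ∣) (∣⁅x⁆∣≡1 x) ⟩
  1 + ∣ p - x ∣                 ∎
  where open ≤-Reasoning

∣p∣>j⇒∣p-x∣≥j : ∀ (p : Subset n) x {j} → j < ∣ p ∣ → j ≤ ∣ p - x ∣
∣p∣>j⇒∣p-x∣≥j p x j<∣p∣ = s≤s⁻¹ (≤-trans j<∣p∣ (∣p∣≤1+∣p-x∣ p x))

Empty⇒∣p∣≡0 : ∀ {p : Subset n} → Empty p → ∣ p ∣ ≡ 0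
Empty⇒∣p∣≡0 {n} e = trans (cong ∣_∣ (Empty-unique e)) (∣⊥∣≡0 n)

∣p∣>0⇒Nonempty : ∀ (p : Subset n) → 0 < ∣ p ∣ → Nonempty p
∣p∣>0⇒Nonempty p ∣p∣>0 with nonempty? p
... | yes ne = ne
... | no  e  = contradiction (Empty⇒∣p∣≡0 e) (>⇒≢ ∣p∣>0)

x∈p⇒∣p∣>0 : ∀ {p : Subset n} {x} → x ∈ p → 0 < ∣ p ∣
x∈p⇒∣p∣>0 x∈p = <-≤-trans (s≤s z≤n) (x∈p⇒∣p-x∣<∣p∣ x∈p)

Empty[p─q]⇒p⊆q : ∀ {p q : Subset n} → Empty (p ─ q) → p ⊆ q
Empty[p─q]⇒p⊆q {q = q} p─q=∅ {x} x∈p with x ∈? q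
... | yes x∈q = x∈q
... | no  x∉q = contradiction (x , x∈p∧x∉q⇒x∈p─q x∈p x∉q) p─q=∅

∣p∣≥2⇒distinct : ∀ (p : Subset n) → 2 ≤ ∣ p ∣ → ∃₂ λ a b → a ∈ p × b ∈ p × a ≢ b
∣p∣≥2⇒distinct p 2≤∣p∣ =
  let a , a∈p = ∣p∣>0⇒Nonempty p (<-≤-trans (s≤s z≤n) 2≤∣p∣)
      b , b∈p-a = ∣p∣>0⇒Nonempty (p - a) (∣p∣>j⇒∣p-x∣≥j p a 2≤∣p∣)
  in a , b , a∈p , p─q⊆p p ⁅ a ⁆ b∈p-a , x∉⁅y⁆⇒x≢y (x∈p─q⇒x∉q b∈p-a) ∘ sym

∈-insertAt⁺ : ∀ {p : Subset n} {i j} → j ∈ p → punchIn i j ∈ insertAt p i outside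
∈-insertAt⁺ {p = p} {i} {j} j∈p =
  lookup⇒[]= _ _ (trans (insertAt-punchIn p i outside j) ([]=⇒lookup j∈p))

∈-insertAt⁻ : ∀ {p : Subset n} {i j} → punchIn i j ∈ insertAt p i outside → j ∈ p
∈-insertAt⁻ {p = p} {i} {j} j∈ =
  lookup⇒[]= _ _ (trans (sym (insertAt-punchIn p i outside j)) ([]=⇒lookup j∈))

i∉insertAt-outside : ∀ (p : Subset n) i → i ∉ insertAt p i outside
i∉insertAt-outside p i i∈ with () ← trans (sym (insertAt-lookup p i outside)) ([]=⇒lookup i∈)

∣insertAt-outside∣ : ∀ (p : Subset n) i → ∣ insertAt p i outside ∣ ≡ ∣ p ∣
∣insertAt-outside∣ p             zero    = refl
∣insertAt-outside∣ (inside  ∷ p) (suc i) = cong suc (∣insertAt-outside∣ p i)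
∣insertAt-outside∣ (outside ∷ p) (suc i) = ∣insertAt-outside∣ p i

insertAt-removeAt-outside : ∀ (p : Subset (suc n)) i → i ∉ p → insertAt (removeAt p i) i outside ≡ p
insertAt-removeAt-outside p i i∉p with lookup p i in pᵢ
... | inside  = contradiction (lookup⇒[]= i p pᵢ) i∉p
... | outside = subst (λ b → insertAt (removeAt p i) i b ≡ p) pᵢ (insertAt-removeAt p i)

module _ {G : Graph n} {T : Subset n} where

  Reach-start : ∀ {u v} → Reach G T u v → u ∈ T
  Reach-start (here u∈T)     = u∈T
  Reach-start (step u∈T _ _) = u∈T

  Reach-trans : ∀ {u v w} → Reach G T u v → Reach G T v w → Reach G T u w
  Reach-trans (here _)         r = r
  Reach-trans (step u∈T uv r′) r = step u∈T uv (Reach-trans r′ r)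

  Reach-sym : ∀ {u v} → Reach G T u v → Reach G T v u
  Reach-sym (here u∈T)              = here u∈T
  Reach-sym (step {u} {w} u∈T uw r) =
    Reach-trans (Reach-sym r) (step (Reach-start r) (trans (adj-sym G w u) uw) (here u∈T))

  Reach-first-step : ∀ {u v} → Reach G T u v → u ≢ v → ∃ λ w → adj G u w ≡ true × w ∈ T
  Reach-first-step (here _)             u≢u = contradiction refl u≢u
  Reach-first-step (step {w = w} _ uw r) _  = w , uw , Reach-start r

CoversEdgesAvoiding : Graph n → Subset n → Subset n → Set
CoversEdgesAvoiding G Z T = ∀ u v → adj G u v ≡ true → u ∉ Z → v ∉ Z → u ∈ T ⊎ v ∈ T

module _ (G : Graph n) {T : Subset n} where

  VertexCover⇒Covers : ∀ {Z} → VertexCover G T → CoversEdgesAvoiding G Z T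
  VertexCover⇒Covers vc u v uv _ _ = vc u v uv

  Covers-mono : ∀ {Z Z′} → Z ⊆ Z′ → CoversEdgesAvoiding G Z T → CoversEdgesAvoiding G Z′ T
  Covers-mono Z⊆Z′ cov u v uv u∉Z′ v∉Z′ = cov u v uv (u∉Z′ ∘ Z⊆Z′) (v∉Z′ ∘ Z⊆Z′)

  Covers⇒nbr∈ : ∀ {Z u v} → CoversEdgesAvoiding G Z T → adj G u v ≡ true →
                u ∉ Z → v ∉ Z → u ∉ T → v ∈ T
  Covers⇒nbr∈ cov uv u∉Z v∉Z u∉T with cov _ _ uv u∉Z v∉Z
  ... | inj₁ u∈T = contradiction u∈T u∉T
  ... | inj₂ v∈T = v∈T

  Covers⇒VertexCover : ∀ {y} → CoversEdgesAvoiding G ⁅ y ⁆ T →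
                       (∀ v → adj G y v ≡ true → v ∈ T) → VertexCover G T
  Covers⇒VertexCover {y} cov nbrs∈T u v uv with u ≟ y | v ≟ y
  ... | yes refl | _        = inj₂ (nbrs∈T v uv)
  ... | no  _    | yes refl = inj₁ (nbrs∈T u (trans (adj-sym G v u) uv))
  ... | no  u≢y  | no  v≢y  = cov u v uv (x≢y⇒x∉⁅y⁆ u≢y) (x≢y⇒x∉⁅y⁆ v≢y)

module _ {m} (G : Graph (suc m)) {y : Fin (suc m)} {S : Subset m} where

  private
    L : Subset (suc m)
    L = insertAt S y outside

    punchOut∈ : ∀ {u} (y≢u : y ≢ u) → u ∈ L → punchOut y≢u ∈ S
    punchOut∈ y≢u u∈L = ∈-insertAt⁻ (subst (_∈ L) (sym (punchIn-punchOut y≢u)) u∈L)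

    y≢∈ : ∀ {u} → u ∈ L → y ≢ u
    y≢∈ u∈L refl = i∉insertAt-outside S y u∈L

  Reach-insertAt⁺ : ∀ {i j} → Reach (delete G y) S i j → Reach G L (punchIn y i) (punchIn y j)
  Reach-insertAt⁺ (here i∈S)      = here (∈-insertAt⁺ i∈S)
  Reach-insertAt⁺ (step i∈S ij r) = step (∈-insertAt⁺ i∈S) ij (Reach-insertAt⁺ r)

  Reach-insertAt⁻ : ∀ {u v} → Reach G L u v → (y≢u : y ≢ u) (y≢v : y ≢ v) →
                    Reach (delete G y) S (punchOut y≢u) (punchOut y≢v)
  Reach-insertAt⁻ (here u∈L) y≢u y≢v =
    subst (Reach (delete G y) S (punchOut y≢u)) (punchOut-cong y refl) (here (punchOut∈ y≢u u∈L))
  Reach-insertAt⁻ (step u∈L uw r) y≢u y≢v =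
    step (punchOut∈ y≢u u∈L)
         (trans (cong₂ (adj G) (punchIn-punchOut y≢u) (punchIn-punchOut y≢w)) uw)
         (Reach-insertAt⁻ r y≢w y≢v)
    where
    y≢w : y ≢ _
    y≢w = y≢∈ (Reach-start r)

  VertexCover-delete : VertexCover G L → VertexCover (delete G y) S
  VertexCover-delete vc i j ij = Sum.map ∈-insertAt⁻ ∈-insertAt⁻ (vc (punchIn y i) (punchIn y j) ij)

  Connected-delete : Connected G L → Connected (delete G y) S
  Connected-delete conn i j i∈S j∈S =
    subst₂ (Reach (delete G y) S) (punchOut-punchIn y) (punchOut-punchIn y)
      (Reach-insertAt⁻ (conn _ _ (∈-insertAt⁺ i∈S) (∈-insertAt⁺ j∈S))
                       (punchInᵢ≢i y i ∘ sym) (punchInᵢ≢i y j ∘ sym))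

  VertexCover-insertAt : VertexCover (delete G y) S → CoversEdgesAvoiding G ⁅ y ⁆ L
  VertexCover-insertAt vc u v uv u∉y v∉y =
    Sum.map (subst (_∈ L) (punchIn-punchOut y≢u) ∘ ∈-insertAt⁺)
            (subst (_∈ L) (punchIn-punchOut y≢v) ∘ ∈-insertAt⁺)
            (vc (punchOut y≢u) (punchOut y≢v)
                (trans (cong₂ (adj G) (punchIn-punchOut y≢u) (punchIn-punchOut y≢v)) uv))
    where
    y≢u : y ≢ u
    y≢u = x∉⁅y⁆⇒x≢y u∉y ∘ sym
    y≢v : y ≢ v
    y≢v = x∉⁅y⁆⇒x≢y v∉y ∘ sym

  Connected-insertAt : Connected (delete G y) S → Connected G L
  Connected-insertAt conn u v u∈L v∈L =
    subst₂ (Reach G L) (punchIn-punchOut (y≢∈ u∈L)) (punchIn-punchOut (y≢∈ v∈L))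
      (Reach-insertAt⁺ (conn _ _ (punchOut∈ (y≢∈ u∈L) u∈L) (punchOut∈ (y≢∈ v∈L) v∈L)))

ConnectedVC-delete-∉ : ∀ {m k} (G : Graph (suc m)) {y T} → y ∉ T → ∣ T ∣ ≤ k →
                       VertexCover G T → Connected G T → ConnectedVC (delete G y) k
ConnectedVC-delete-∉ G {y} {T} y∉T ∣T∣≤k vc conn =
  removeAt T y ,
  subst (_≤ _) (trans (sym (cong ∣_∣ T≡)) (∣insertAt-outside∣ (removeAt T y) y)) ∣T∣≤k ,
  VertexCover-delete G (subst (VertexCover G) (sym T≡) vc) ,
  Connected-delete G (subst (Connected G) (sym T≡) conn)
  where
  T≡ : insertAt (removeAt T y) y outside ≡ T
  T≡ = insertAt-removeAt-outside T y y∉T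

∈nbrsOutside⁻ : ∀ (G : Graph n) X {z v} → v ∈ nbrsOutside G X z → adj G z v ≡ true × v ∉ X
∈nbrsOutside⁻ G X {z} {v} v∈
  with adj G z v | lookup X v in Xᵥ | ∈-tabulate⁻ {f = λ u → adj G z u ∧ not (lookup X u)} v∈
... | true | false | _ = refl , λ v∈X → contradiction (trans (sym ([]=⇒lookup v∈X)) Xᵥ) λ ()

module _ (G : Graph n) (X : Subset n) {T : Subset n} {z : Fin n} (z∉T : z ∉ T) where

  ∣nbrsOutside∣≤∣cover∣ : VertexCover G T → ∣ nbrsOutside G X z ∣ ≤ ∣ T ∣
  ∣nbrsOutside∣≤∣cover∣ vc = p⊆q⇒∣p∣≤∣q∣ nbrs⊆T
    where
    nbrs⊆T : nbrsOutside G X z ⊆ T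
    nbrs⊆T v∈ =
      Covers⇒nbr∈ G {Z = ⊥} (VertexCover⇒Covers G vc) (proj₁ (∈nbrsOutside⁻ G X v∈)) ∉⊥ ∉⊥ z∉T

  ∣nbrsOutside∣≤∣almost-cover∣ : ∀ {y w} → CoversEdgesAvoiding G ⁅ y ⁆ T → z ∉ ⁅ y ⁆ →
                                 w ∈ T → w ∈ X → ∣ nbrsOutside G X z ∣ ≤ ∣ T ∣
  ∣nbrsOutside∣≤∣almost-cover∣ {y} {w} cov z∉y w∈T w∈X = begin
    ∣ nbrsOutside G X z ∣     ≤⟨ p⊆q⇒∣p∣≤∣q∣ nbrs⊆ ⟩
    ∣ (T - w) ∪ ⁅ y ⁆ ∣       ≤⟨ ∣p∪q∣≤∣p∣+∣q∣ (T - w) ⁅ y ⁆ ⟩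
    ∣ T - w ∣ + ∣ ⁅ y ⁆ ∣     ≡⟨ cong (∣ T - w ∣ +_) (∣⁅x⁆∣≡1 y) ⟩
    ∣ T - w ∣ + 1             ≡⟨ +-comm ∣ T - w ∣ 1 ⟩
    suc ∣ T - w ∣             ≤⟨ x∈p⇒∣p-x∣<∣p∣ w∈T ⟩
    ∣ T ∣                     ∎
    where
    open ≤-Reasoning
    nbrs⊆ : nbrsOutside G X z ⊆ (T - w) ∪ ⁅ y ⁆
    nbrs⊆ {v} v∈ with v ≟ y | ∈nbrsOutside⁻ G X v∈
    ... | yes refl | _          = x∈p∪q⁺ (inj₂ (x∈⁅x⁆ v))
    ... | no  v≢y  | zv , v∉X =
      x∈p∪q⁺ (inj₁ (x∈p∧x≢y⇒x∈p-y (Covers⇒nbr∈ G cov zv z∉y (x≢y⇒x∉⁅y⁆ v≢y) z∉T)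
                                   λ { refl → v∉X w∈X }))

module ModuleOutsideCover (G : Graph n) (X Y : Subset n)
                          (vcX : VertexCover G X) (Y⊆∁X : Y ⊆ ∁ X) (modY : IsModule G Y) where

  ∈Y⇒∉X : ∀ {u} → u ∈ Y → u ∉ X
  ∈Y⇒∉X u∈Y = x∈∁p⇒x∉p (Y⊆∁X u∈Y)

  nbr-Y⇒∉Y : ∀ {u v} → u ∈ Y → adj G u v ≡ true → v ∉ Y
  nbr-Y⇒∉Y {u} {v} u∈Y uv v∈Y with vcX u v uv
  ... | inj₁ u∈X = ∈Y⇒∉X u∈Y u∈X
  ... | inj₂ v∈X = ∈Y⇒∉X v∈Y v∈X

  nbr-Y⇒∈X : ∀ {u w} → u ∈ Y → adj G w u ≡ true → w ∈ X
  nbr-Y⇒∈X {u} {w} u∈Y wu with vcX w u wu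
  ... | inj₁ w∈X = w∈X
  ... | inj₂ u∈X = contradiction u∈X (∈Y⇒∉X u∈Y)

  nbr-Y⇒nbr-Y : ∀ {u v w} → u ∈ Y → v ∈ Y → adj G w u ≡ true → adj G w v ≡ true
  nbr-Y⇒nbr-Y {u} {v} {w} u∈Y v∈Y wu =
    trans (sym (modY w (nbr-Y⇒∉Y u∈Y (trans (adj-sym G u w) wu)) u v u∈Y v∈Y)) wu

  ∈nbrsInSmall : ∀ {k u z} → u ∈ Y → adj G z u ≡ true → ∣ nbrsOutside G X z ∣ ≤ k →
                 z ∈ nbrsInSmall G X k Y
  ∈nbrsInSmall {k} {u} {z} u∈Y zu deg = ∈-tabulate⁺ (cong₂ _∧_ small adjacent)
    where
    small : lookup (smallPart G X k) z ≡ true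
    small = trans (lookup∘tabulate _ z)
                  (cong₂ _∧_ ([]=⇒lookup (nbr-Y⇒∈X u∈Y zu)) (Equivalence.to T-≡ (≤⇒≤ᵇ deg)))
    adjacent : any (λ v → lookup Y v ∧ adj G z v) (allFin n) ≡ true
    adjacent = Equivalence.to T-≡ (any⁺ _ (Any.map (λ { refl → Equivalence.from T-≡
                 (cong₂ _∧_ ([]=⇒lookup u∈Y) zu) }) (∈-allFin u)))

  module Exchange {y₀ : Fin n} (y₀∈Y : y₀ ∈ Y) where

    -- Since Y is a module, the neighbourhood of y₀ is N(Y).
    N : Subset n
    N = tabulate (adj G y₀)

    nbr-Y⇒∈N : ∀ {u v} → u ∈ Y → adj G u v ≡ true → v ∈ N
    nbr-Y⇒∈N {u} {v} u∈Y uv =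
      ∈-tabulate⁺ (trans (adj-sym G y₀ v) (nbr-Y⇒nbr-Y u∈Y y₀∈Y (trans (adj-sym G v u) uv)))

    ∈N⇒∉Y : ∀ {v} → v ∈ N → v ∉ Y
    ∈N⇒∉Y v∈N = nbr-Y⇒∉Y y₀∈Y (∈-tabulate⁻ v∈N)

    exchange : Subset n → Subset n
    exchange P = (P ─ Y) ∪ (N ─ P) ∪ ⁅ y₀ ⁆

    module _ {P : Subset n} where

      ∈exchange : ∀ {v} → v ∈ P → v ∉ Y → v ∈ exchange P
      ∈exchange v∈P v∉Y = x∈p∪q⁺ (inj₁ (x∈p∧x∉q⇒x∈p─q v∈P v∉Y))

      N⊆exchange : N ⊆ exchange P
      N⊆exchange {v} v∈N with v ∈? P
      ... | yes v∈P = ∈exchange v∈P (∈N⇒∉Y v∈N)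
      ... | no  v∉P = x∈p∪q⁺ (inj₂ (x∈p∪q⁺ (inj₁ (x∈p∧x∉q⇒x∈p─q v∈N v∉P))))

      y₀∈exchange : y₀ ∈ exchange P
      y₀∈exchange = x∈p∪q⁺ (inj₂ (x∈p∪q⁺ (inj₂ (x∈⁅x⁆ y₀))))

      exchange⁻ : ∀ {v} → v ∈ exchange P → (v ∈ P × v ∉ Y) ⊎ v ∈ N ⊎ v ≡ y₀
      exchange⁻ v∈ with x∈p∪q⁻ (P ─ Y) _ v∈
      ... | inj₁ v∈P─Y = inj₁ (p─q⊆p P Y v∈P─Y , x∈p─q⇒x∉q v∈P─Y)
      ... | inj₂ v∈ʳ with x∈p∪q⁻ (N ─ P) ⁅ y₀ ⁆ v∈ʳ
      ...   | inj₁ v∈N─P = inj₂ (inj₁ (p─q⊆p N P v∈N─P))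
      ...   | inj₂ v∈y₀  = inj₂ (inj₂ (x∈⁅y⁆⇒x≡y y₀ v∈y₀))

      exchange-avoids : ∀ {u} → u ∈ Y → u ≢ y₀ → u ∉ exchange P
      exchange-avoids u∈Y u≢y₀ u∈ with exchange⁻ u∈
      ... | inj₁ (_ , u∉Y)  = u∉Y u∈Y
      ... | inj₂ (inj₁ u∈N) = ∈N⇒∉Y u∈N u∈Y
      ... | inj₂ (inj₂ u≡y₀) = u≢y₀ u≡y₀

      exchange-covers : CoversEdgesAvoiding G Y P → VertexCover G (exchange P)
      exchange-covers cov u v uv with u ∈? Y | v ∈? Y
      ... | yes u∈Y | _       = inj₂ (N⊆exchange (nbr-Y⇒∈N u∈Y uv))
      ... | no  _   | yes v∈Y = inj₁ (N⊆exchange (nbr-Y⇒∈N v∈Y (trans (adj-sym G v u) uv)))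
      ... | no  u∉Y | no  v∉Y =
        Sum.map (λ u∈P → ∈exchange u∈P u∉Y) (λ v∈P → ∈exchange v∈P v∉Y) (cov u v uv u∉Y v∉Y)

      exchange-connected : ∀ {t} → t ∈ P → t ∈ Y → Connected G P → Connected G (exchange P)
      exchange-connected {t} t∈P t∈Y conn u v u∈ v∈ = Reach-trans (to-y₀ u∈) (Reach-sym (to-y₀ v∈))
        where
        -- Follow a path of G[P] into Y; at its first vertex in Y jump to y₀ instead.
        walk : ∀ {u v} → Reach G P u v → v ∈ Y → u ∉ Y → Reach G (exchange P) u y₀
        walk (here _) v∈Y u∉Y = contradiction v∈Y u∉Y
        walk (step {w = w} u∈P uw r) v∈Y u∉Y with w ∈? Y
        ... | yes w∈Y = step (∈exchange u∈P u∉Y) (nbr-Y⇒nbr-Y w∈Y y₀∈Y uw) (here y₀∈exchange)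
        ... | no  w∉Y = step (∈exchange u∈P u∉Y) uw (walk r v∈Y w∉Y)

        to-y₀ : ∀ {u} → u ∈ exchange P → Reach G (exchange P) u y₀
        to-y₀ {u} u∈ with exchange⁻ u∈
        ... | inj₁ (u∈P , u∉Y)  = walk (conn u t u∈P t∈P) t∈Y u∉Y
        ... | inj₂ (inj₁ u∈N)   =
          step u∈ (trans (adj-sym G u y₀) (∈-tabulate⁻ u∈N)) (here y₀∈exchange)
        ... | inj₂ (inj₂ refl) = here u∈

      exchange-size : ∣ N ─ P ∣ + 1 ≤ ∣ P ∩ Y ∣ → ∣ exchange P ∣ ≤ ∣ P ∣
      exchange-size bound = begin
        ∣ exchange P ∣                        ≤⟨ ∣p∪q∣≤∣p∣+∣q∣ (P ─ Y) _ ⟩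
        ∣ P ─ Y ∣ + ∣ (N ─ P) ∪ ⁅ y₀ ⁆ ∣      ≤⟨ +-monoʳ-≤ ∣ P ─ Y ∣ (∣p∪q∣≤∣p∣+∣q∣ (N ─ P) ⁅ y₀ ⁆) ⟩
        ∣ P ─ Y ∣ + (∣ N ─ P ∣ + ∣ ⁅ y₀ ⁆ ∣)  ≡⟨ cong (λ c → ∣ P ─ Y ∣ + (∣ N ─ P ∣ + c)) (∣⁅x⁆∣≡1 y₀) ⟩
        ∣ P ─ Y ∣ + (∣ N ─ P ∣ + 1)           ≤⟨ +-monoʳ-≤ ∣ P ─ Y ∣ bound ⟩
        ∣ P ─ Y ∣ + ∣ P ∩ Y ∣                 ≡⟨ +-comm ∣ P ─ Y ∣ ∣ P ∩ Y ∣ ⟩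
        ∣ P ∩ Y ∣ + ∣ P ─ Y ∣                 ≡⟨ ∣p∣≡∣p∩q∣+∣p─q∣ P Y ⟨
        ∣ P ∣                                 ∎
        where open ≤-Reasoning

      Y-y⊆P : ∀ {y} → y ∈ Y → CoversEdgesAvoiding G ⁅ y ⁆ P → Nonempty (N ─ P) → Y - y ⊆ P
      Y-y⊆P y∈Y cov (x , x∈N─P) v∈Y-y =
        Covers⇒nbr∈ G cov
          (nbr-Y⇒nbr-Y y₀∈Y (p─q⊆p Y ⁅ _ ⁆ v∈Y-y) (trans (adj-sym G x y₀) (∈-tabulate⁻ x∈N)))
          (x≢y⇒x∉⁅y⁆ λ { refl → ∈N⇒∉Y x∈N y∈Y }) (x∈p─q⇒x∉q v∈Y-y) (x∈p─q⇒x∉q x∈N─P)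
        where
        x∈N : x ∈ N
        x∈N = p─q⊆p N P x∈N─P

      exchange-bound : ∀ {k y} → y ∈ Y → CoversEdgesAvoiding G ⁅ y ⁆ P → Nonempty (N ─ P) →
                       (∀ {z} → z ∈ N ─ P → ∣ nbrsOutside G X z ∣ ≤ k) →
                       ∣ nbrsInSmall G X k Y ∣ + 1 ≤ ∣ Y - y ∣ → ∣ N ─ P ∣ + 1 ≤ ∣ P ∩ Y ∣
      exchange-bound {k} {y} y∈Y cov N⊈P deg ∣Y-y∣≥ = begin
        ∣ N ─ P ∣ + 1                  ≤⟨ +-monoˡ-≤ 1 (p⊆q⇒∣p∣≤∣q∣ N─P⊆Xᵢ) ⟩
        ∣ nbrsInSmall G X k Y ∣ + 1    ≤⟨ ∣Y-y∣≥ ⟩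
        ∣ Y - y ∣                      ≤⟨ p⊆q⇒∣p∣≤∣q∣ Y-y⊆P∩Y ⟩
        ∣ P ∩ Y ∣                      ∎
        where
        open ≤-Reasoning
        N─P⊆Xᵢ : N ─ P ⊆ nbrsInSmall G X k Y
        N─P⊆Xᵢ {z} z∈ =
          ∈nbrsInSmall y₀∈Y (trans (adj-sym G z y₀) (∈-tabulate⁻ (p─q⊆p N P z∈))) (deg z∈)
        Y-y⊆P∩Y : Y - y ⊆ P ∩ Y
        Y-y⊆P∩Y v∈ = x∈p∩q⁺ (Y-y⊆P y∈Y cov N⊈P v∈ , p─q⊆p Y ⁅ y ⁆ v∈)

module Reduction {m} {G : Graph (suc m)} {k} {X Y : Subset (suc m)}
                 (vcX : VertexCover G X) (Y⊆∁X : Y ⊆ ∁ X) (modY : IsModule G Y)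
                 {y} (y∈Y : y ∈ Y) (∣Y-y∣≥ : ∣ nbrsInSmall G X k Y ∣ + 1 ≤ ∣ Y - y ∣)
                 {y₀ y₁} (y₀∈Y-y : y₀ ∈ Y - y) (y₁∈Y-y : y₁ ∈ Y - y) (y₀≢y₁ : y₀ ≢ y₁) where

  open ModuleOutsideCover G X Y vcX Y⊆∁X modY

  y₀∈Y : y₀ ∈ Y
  y₀∈Y = p─q⊆p Y ⁅ y ⁆ y₀∈Y-y

  open Exchange y₀∈Y

  ConnectedVC⇒delete : ConnectedVC G k → ConnectedVC (delete G y) k
  ConnectedVC⇒delete (T , ∣T∣≤k , vc , conn) with y ∈? T
  ... | no  y∉T = ConnectedVC-delete-∉ G y∉T ∣T∣≤k vc conn
  ... | yes y∈T =
    ConnectedVC-delete-∉ G {T = exchange T}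
      (exchange-avoids y∈Y (x∉⁅y⁆⇒x≢y (x∈p─q⇒x∉q y₀∈Y-y) ∘ sym))
      (≤-trans (exchange-size {P = T} bound) ∣T∣≤k)
      (exchange-covers (VertexCover⇒Covers G vc)) (exchange-connected y∈T y∈Y conn)
    where
    bound : ∣ N ─ T ∣ + 1 ≤ ∣ T ∩ Y ∣
    bound with nonempty? (N ─ T)
    ... | no  N⊆T = subst (_≤ ∣ T ∩ Y ∣) (cong (_+ 1) (sym (Empty⇒∣p∣≡0 N⊆T)))
                          (x∈p⇒∣p∣>0 (x∈p∩q⁺ (y∈T , y∈Y)))
    ... | yes N⊈T = exchange-bound {P = T} y∈Y (VertexCover⇒Covers G vc) N⊈T
                      (λ z∈ → ≤-trans (∣nbrsOutside∣≤∣cover∣ G X (x∈p─q⇒x∉q z∈) vc) ∣T∣≤k) ∣Y-y∣≥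

  delete⇒ConnectedVC : ConnectedVC (delete G y) k → ConnectedVC G k
  delete⇒ConnectedVC (S , ∣S∣≤k , vc , conn) = extend (nonempty? (N ─ L))
    where
    L : Subset (suc m)
    L = insertAt S y outside

    ∣L∣≤k : ∣ L ∣ ≤ k
    ∣L∣≤k = subst (_≤ k) (sym (∣insertAt-outside∣ S y)) ∣S∣≤k

    cov : CoversEdgesAvoiding G ⁅ y ⁆ L
    cov = VertexCover-insertAt G vc

    connL : Connected G L
    connL = Connected-insertAt G conn

    extend : Dec (Nonempty (N ─ L)) → ConnectedVC G k
    extend (no N⊆L) =
      L , ∣L∣≤k , Covers⇒VertexCover G cov (λ _ yv → Empty[p─q]⇒p⊆q N⊆L (nbr-Y⇒∈N y∈Y yv)) , connL
    extend (yes N⊈L) =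
      exchange L ,
      ≤-trans (exchange-size {P = L} (exchange-bound {P = L} y∈Y cov N⊈L deg ∣Y-y∣≥)) ∣L∣≤k ,
      exchange-covers {P = L} (Covers-mono G ⁅y⁆⊆Y cov) , exchange-connected y₀∈L y₀∈Y connL
      where
      ⁅y⁆⊆Y : ⁅ y ⁆ ⊆ Y
      ⁅y⁆⊆Y v∈ = subst (_∈ Y) (sym (x∈⁅y⁆⇒x≡y y v∈)) y∈Y

      Y-y⊆L : Y - y ⊆ L
      Y-y⊆L = Y-y⊆P {P = L} y∈Y cov N⊈L

      y₀∈L : y₀ ∈ L
      y₀∈L = Y-y⊆L y₀∈Y-y

      -- G[L] joins y₀ to y₁ ≠ y₀, so y₀ has a neighbour w ∈ L, which lies in X.
      deg : ∀ {z} → z ∈ N ─ L → ∣ nbrsOutside G X z ∣ ≤ k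
      deg {z} z∈ =
        let w , y₀w , w∈L = Reach-first-step (connL y₀ y₁ y₀∈L (Y-y⊆L y₁∈Y-y)) y₀≢y₁
            z∉y : z ∉ ⁅ y ⁆
            z∉y = x≢y⇒x∉⁅y⁆ λ { refl → ∈N⇒∉Y (p─q⊆p N L z∈) y∈Y }
        in ≤-trans (∣nbrsOutside∣≤∣almost-cover∣ G X (x∈p─q⇒x∉q z∈) cov z∉y w∈L
                     (nbr-Y⇒∈X y₀∈Y (trans (adj-sym G w y₀) y₀w))) ∣L∣≤k

lemma27 : ∀ {m} (G : Graph (suc m)) (k : ℕ) (X : Subset (suc m)) → VertexCover G X →
          (Y : Subset (suc m)) → MaximalModuleOutside G X Y →
          Nonempty (nbrsInSmall G X k Y) → ∣ nbrsInSmall G X k Y ∣ + 2 ≤ ∣ Y ∣ →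
          (y : Fin (suc m)) → y ∈ Y →
          (ConnectedVC G k ⇔ ConnectedVC (delete G y) k)
lemma27 G k X vcX Y (_ , Y⊆∁X , modY , _) (_ , x∈Xᵢ) ∣Y∣≥ y y∈Y =
  let ∣Y-y∣≥ = ∣p∣>j⇒∣p-x∣≥j Y y (subst (_≤ ∣ Y ∣) (+-suc _ 1) ∣Y∣≥)
      y₀ , y₁ , y₀∈Y-y , y₁∈Y-y , y₀≢y₁ =
        ∣p∣≥2⇒distinct (Y - y) (≤-trans (+-monoˡ-≤ 1 (x∈p⇒∣p∣>0 x∈Xᵢ)) ∣Y-y∣≥)
      open Reduction vcX Y⊆∁X modY y∈Y ∣Y-y∣≥ y₀∈Y-y y₁∈Y-y y₀≢y₁
  in mk⇔ ConnectedVC⇒delete delete⇒ConnectedVC
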